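{- $\mathsf{GAP} \leq_{sc} \mathsf{RT}^3_{5,4}$: for every increasing function $g : \omega \to \omega$ there is a coloring $f : [\omega]^3 \to 5$ such that every infinite set $H$ with $|f[H]^3| \leq 4$ computes an infinite $g$-transitive set.
   Context: $[\omega]^3$ is the set of 3-element subsets of $\omega$. Given $g : \omega \to \omega$, an interval $[a,b]$ is $g$-large if $b \geq g(a)$ and $g$-small otherwise. A set $H$ is $g$-transitive if for every $x < y < z$ in $H$ such that $[x,y]$ and $[y,z]$ are $g$-small, $[x,z]$ is $g$-small. -}

module Defs where

open import Data.Nat using (ℕ; zero; suc; _<_; _≤_; _≥_)
open import Data.Fin using (Fin; toℕ)
open import Data.Vec using (Vec; []; _∷_; lookup)
open import Data.List using (List; length)
open import Data.List.Membership.Propositional using (_∈_)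
open import Data.Bool using (Bool; true; false; if_then_else_)
open import Data.Product using (Σ; _×_; ∃)
open import Relation.Binary.PropositionalEquality using (_≡_)

data Code : ℕ → Set where
  zer  : ∀ {n} → Code n
  succ : Code 1
  proj : ∀ {n} → Fin n → Code n
  orc  : Code 1
  comp : ∀ {m n} → Code m → Vec (Code n) m → Code n
  prec : ∀ {n} → Code n → Code (suc (suc n)) → Code (suc n)
  mu   : ∀ {n} → Code (suc n) → Code n

mutual
  data Eval (α : ℕ → ℕ) : ∀ {n} → Code n → Vec ℕ n → ℕ → Set where
    ev-zer  : ∀ {n} {xs : Vec ℕ n} → Eval α zer xs 0
    ev-succ : ∀ {x} → Eval α succ (x ∷ []) (suc x)
    ev-proj : ∀ {n} {i : Fin n} {xs} → Eval α (proj i) xs (lookup xs i)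
    ev-orc  : ∀ {x} → Eval α orc (x ∷ []) (α x)
    ev-comp : ∀ {m n} {f : Code m} {gs : Vec (Code n) m} {xs ys r} →
              EvalVec α gs xs ys → Eval α f ys r → Eval α (comp f gs) xs r
    ev-prec0 : ∀ {n} {f : Code n} {h : Code (suc (suc n))} {xs r} →
               Eval α f xs r → Eval α (prec f h) (0 ∷ xs) r
    ev-precS : ∀ {n} {f : Code n} {h : Code (suc (suc n))} {k xs r r'} →
               Eval α (prec f h) (k ∷ xs) r → Eval α h (k ∷ r ∷ xs) r' →
               Eval α (prec f h) (suc k ∷ xs) r'
    ev-mu   : ∀ {n} {f : Code (suc n)} {xs y} →
              Eval α f (y ∷ xs) 0 →
              (∀ z → z < y → Σ ℕ λ k → Eval α f (z ∷ xs) (suc k)) →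
              Eval α (mu f) xs y

  data EvalVec (α : ℕ → ℕ) {n : ℕ} : ∀ {m} → Vec (Code n) m → Vec ℕ n → Vec ℕ m → Set where
    []  : ∀ {xs} → EvalVec α [] xs []
    _∷_ : ∀ {m} {g : Code n} {gs : Vec (Code n) m} {xs y ys} →
          Eval α g xs y → EvalVec α gs xs ys → EvalVec α (g ∷ gs) xs (y ∷ ys)

ComputesFn : (ℕ → ℕ) → (ℕ → ℕ) → Set
ComputesFn α β = Σ (Code 1) λ e → ∀ n → Eval α e (n ∷ []) (β n)

Subset : Set
Subset = ℕ → Bool

χ : Subset → ℕ → ℕ
χ H n = if H n then 1 else 0

Computes : Subset → Subset → Set
Computes H X = ComputesFn (χ H) (χ X)

Infinite : Subset → Set
Infinite H = ∀ n → Σ ℕ λ m → (n < m) × (H m ≡ true)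

StrictlyIncreasing : (ℕ → ℕ) → Set
StrictlyIncreasing g = ∀ m n → m < n → g m < g n

GLarge : (ℕ → ℕ) → ℕ → ℕ → Set
GLarge g a b = b ≥ g a

GSmall : (ℕ → ℕ) → ℕ → ℕ → Set
GSmall g a b = b < g a

GTransitive : (ℕ → ℕ) → Subset → Set
GTransitive g H = ∀ x y z → H x ≡ true → H y ≡ true → H z ≡ true →
  x < y → y < z → GSmall g x y → GSmall g y z → GSmall g x z

-- Colorings of [ω]^3 with k colors: a function on triples, only
-- consulted on x < y < z.

Coloring3 : ℕ → Set
Coloring3 k = ℕ → ℕ → ℕ → Fin k

ColoringComputableFrom : ∀ {k} → (ℕ → ℕ) → Coloring3 k → Set
ColoringComputableFrom α f = Σ (Code 3) λ e → ∀ x y z → x < y → y < z →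
  Eval α e (x ∷ y ∷ z ∷ []) (toℕ (f x y z))

UsesAtMost : ∀ {k} → ℕ → Coloring3 k → Subset → Set
UsesAtMost {k} ℓ f H = Σ (List (Fin k)) λ L → (length L ≤ ℓ) ×
  (∀ x y z → H x ≡ true → H y ≡ true → H z ≡ true → x < y → y < z → f x y z ∈ L)

-- Colour x < y < z by whether [x,y] and [y,z] are g-small and, when both are, whether [x,z]
-- is. An H using at most four colours omits one, and an infinite H cannot omit
-- "large, large". If H omits "small, small, large" it is g-transitive itself; otherwise an
-- H-computable infinite subset has no g-small pairs at all:
--   * omitting "small, large": H itself, as a g-small [x,y] extends by a far z ∈ H;
--   * omitting "large, small": the elements of H beyond g(m), for a fixed m ∈ H;
--   * omitting "small, small, small": every other element of H, since between two of them
--     a < b lies some y ∈ H, and if [a,b] is g-small then so are [a,y] and, g being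
--     increasing, [y,b].
module Submission where

open import Defs
open import Data.Nat using (ℕ; zero; suc; _+_; _∸_; _⊔_; _<_; _≤_; z≤n; s≤s; _<?_; pred)
open import Data.Nat.Properties
open import Data.Fin using (Fin; toℕ)
import Data.Fin as Fin
import Data.Fin.Properties as Fin
open import Data.Vec using (Vec; []; _∷_; lookup)
open import Data.List using (List; length)
import Data.List as List
open import Data.List.Membership.Propositional using (_∈_; _∉_)
open import Data.List.Relation.Unary.Any using (index; any?)
open import Data.List.Relation.Unary.Any.Properties using (lookup-index)
open import Data.Bool using (true; false; _∧_)
open import Data.Product using (Σ; ∃; _×_; _,_; proj₁)
open import Data.Sum using (inj₁; inj₂)
open import Data.Empty using (⊥-elim)
open import Relation.Nullary using (¬_; yes; no)
open import Relation.Binary.PropositionalEquality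

ifZero : {A : Set} → ℕ → A → A → A
ifZero zero    a _ = a
ifZero (suc _) _ b = b

infixl 6 _⊕_ _⊝_

#_ : ∀ {n} → ℕ → Code n
# zero  = zer
# suc k = comp succ (# k ∷ [])

oracle : ∀ {n} → Code n → Code n
oracle e = comp orc (e ∷ [])

predCode : Code 1
predCode = prec zer (proj Fin.zero)

addCode : Code 2
addCode = prec (proj Fin.zero) (comp succ (proj (Fin.suc Fin.zero) ∷ []))

monusCode : Code 2
monusCode = prec (proj Fin.zero) (comp predCode (proj (Fin.suc Fin.zero) ∷ []))

ifZeroCode : Code 3
ifZeroCode = prec (proj Fin.zero) (proj (Fin.suc (Fin.suc (Fin.suc Fin.zero))))

_⊕_ _⊝_ : ∀ {n} → Code n → Code n → Code n
a ⊕ b = comp addCode (a ∷ b ∷ [])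
a ⊝ b = comp monusCode (b ∷ a ∷ [])

ifZeroᶜ : ∀ {n} → Code n → Code n → Code n → Code n
ifZeroᶜ t a b = comp ifZeroCode (t ∷ a ∷ b ∷ [])

module _ {α : ℕ → ℕ} where

  eval-# : ∀ {n} k {xs : Vec ℕ n} → Eval α (# k) xs k
  eval-# zero    = ev-zer
  eval-# (suc k) = ev-comp (eval-# k ∷ []) ev-succ

  eval-oracle : ∀ {n} {e : Code n} {xs k} → Eval α e xs k → Eval α (oracle e) xs (α k)
  eval-oracle ev = ev-comp (ev ∷ []) ev-orc

  eval-pred : ∀ k → Eval α predCode (k ∷ []) (pred k)
  eval-pred zero    = ev-prec0 ev-zer
  eval-pred (suc k) = ev-precS (eval-pred k) ev-proj

  eval-add : ∀ k m → Eval α addCode (k ∷ m ∷ []) (k + m)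
  eval-add zero    m = ev-prec0 ev-proj
  eval-add (suc k) m = ev-precS (eval-add k m) (ev-comp (ev-proj ∷ []) ev-succ)

  eval-monus : ∀ k m → Eval α monusCode (k ∷ m ∷ []) (m ∸ k)
  eval-monus zero    m = ev-prec0 ev-proj
  eval-monus (suc k) m = subst (Eval α monusCode (suc k ∷ m ∷ [])) (pred[m∸n]≡m∸[1+n] m k)
    (ev-precS (eval-monus k m) (ev-comp (ev-proj ∷ []) (eval-pred (m ∸ k))))

  eval-ifZeroCode : ∀ t a b → Eval α ifZeroCode (t ∷ a ∷ b ∷ []) (ifZero t a b)
  eval-ifZeroCode zero    a b = ev-prec0 ev-proj
  eval-ifZeroCode (suc t) a b = ev-precS (eval-ifZeroCode t a b) ev-proj

  module _ {n} {xs : Vec ℕ n} {a b : Code n} {k m : ℕ} where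

    eval-⊕ : Eval α a xs k → Eval α b xs m → Eval α (a ⊕ b) xs (k + m)
    eval-⊕ ea eb = ev-comp (ea ∷ eb ∷ []) (eval-add k m)

    eval-⊝ : Eval α a xs k → Eval α b xs m → Eval α (a ⊝ b) xs (k ∸ m)
    eval-⊝ ea eb = ev-comp (eb ∷ ea ∷ []) (eval-monus m k)

    eval-ifZero : ∀ {t s} → Eval α t xs s → Eval α a xs k → Eval α b xs m →
                  Eval α (ifZeroᶜ t a b) xs (ifZero s k m)
    eval-ifZero {s = s} et ea eb = ev-comp (et ∷ ea ∷ eb ∷ []) (eval-ifZeroCode s k m)

pattern LL  = Fin.zero
pattern LS  = Fin.suc Fin.zero
pattern SL  = Fin.suc (Fin.suc Fin.zero)
pattern SSL = Fin.suc (Fin.suc (Fin.suc Fin.zero))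
pattern SSS = Fin.suc (Fin.suc (Fin.suc (Fin.suc Fin.zero)))

-- S/L records whether [x,y], [y,z], [x,z] are g-small or g-large. The arguments are
-- g x ∸ y, g y ∸ z and g x ∸ z, and g a ∸ b vanishes iff [a,b] is g-large.
colour : ℕ → ℕ → ℕ → Fin 5
colour zero    zero    _       = LL
colour zero    (suc _) _       = LS
colour (suc _) zero    _       = SL
colour (suc _) (suc _) zero    = SSL
colour (suc _) (suc _) (suc _) = SSS

colouring : (ℕ → ℕ) → Coloring3 5
colouring g x y z = colour (g x ∸ y) (g y ∸ z) (g x ∸ z)

module _ {a b c : ℕ} where

  colour-LL : a ≡ 0 → b ≡ 0 → colour a b c ≡ LL
  colour-LL refl refl = refl

  colour-LS : a ≡ 0 → 0 < b → colour a b c ≡ LS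
  colour-LS refl (s≤s _) = refl

  colour-SL : 0 < a → b ≡ 0 → colour a b c ≡ SL
  colour-SL (s≤s _) refl = refl

  colour-SSL : 0 < a → 0 < b → c ≡ 0 → colour a b c ≡ SSL
  colour-SSL (s≤s _) (s≤s _) refl = refl

  colour-SSS : 0 < a → 0 < b → 0 < c → colour a b c ≡ SSS
  colour-SSS (s≤s _) (s≤s _) (s≤s _) = refl

toℕ-colour : ∀ a b c →
  toℕ (colour a b c) ≡ ifZero a (ifZero b 0 1) (ifZero b 2 (ifZero c 3 4))
toℕ-colour zero    zero    _       = refl
toℕ-colour zero    (suc _) _       = refl
toℕ-colour (suc _) zero    _       = refl
toℕ-colour (suc _) (suc _) zero    = refl
toℕ-colour (suc _) (suc _) (suc _) = refl

colouringCode : Code 3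
colouringCode = ifZeroᶜ (gx ⊝ y) (ifZeroᶜ (gy ⊝ z) (# 0) (# 1))
                                 (ifZeroᶜ (gy ⊝ z) (# 2) (ifZeroᶜ (gx ⊝ z) (# 3) (# 4)))
  where
  x y z gx gy : Code 3
  x  = proj Fin.zero
  y  = proj (Fin.suc Fin.zero)
  z  = proj (Fin.suc (Fin.suc Fin.zero))
  gx = oracle x
  gy = oracle y

colouring-computable : (g : ℕ → ℕ) → ColoringComputableFrom g (colouring g)
colouring-computable g = colouringCode , λ x y z _ _ →
  subst (Eval g colouringCode (x ∷ y ∷ z ∷ [])) (sym (toℕ-colour (g x ∸ y) (g y ∸ z) (g x ∸ z)))
    (eval-ifZero g-difference (eval-ifZero g-difference (eval-# 0) (eval-# 1))
      (eval-ifZero g-difference (eval-# 2) (eval-ifZero g-difference (eval-# 3) (eval-# 4))))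
  where
  g-difference : ∀ {i j : Fin 3} {xs} → Eval g (oracle (proj i) ⊝ proj j) xs (g (lookup xs i) ∸ lookup xs j)
  g-difference = eval-⊝ (eval-oracle ev-proj) ev-proj

Omits : ∀ {k} → Coloring3 k → Fin k → Subset → Set
Omits f c H = ∀ {x y z} → H x ≡ true → H y ≡ true → H z ≡ true → x < y → y < z → f x y z ≢ c

∃∉-of-short-list : ∀ {k} (L : List (Fin k)) → length L < k → ∃ λ c → c ∉ L
∃∉-of-short-list {k} L short = Fin.¬∀⟶∃¬ k (_∈ L) (λ c → any? (c Fin.≟_) L) all∉
  where
  all∉ : ¬ (∀ c → c ∈ L)
  all∉ all∈ with Fin.pigeonhole short (λ c → index (all∈ c))
  ... | i , j , i<j , same = Fin.<-irrefl i≡j i<j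
    where
    i≡j : i ≡ j
    i≡j = trans (lookup-index (all∈ i))
                (trans (cong (List.lookup L) same) (sym (lookup-index (all∈ j))))

omitted-colour : ∀ {k ℓ H} (f : Coloring3 k) → UsesAtMost ℓ f H → ℓ < k → ∃ λ c → Omits f c H
omitted-colour f (L , length≤ℓ , f∈L) ℓ<k with ∃∉-of-short-list L (≤-<-trans length≤ℓ ℓ<k)
... | c , c∉L = c , λ hx hy hz x<y y<z fxyz≡c →
  c∉L (subst (_∈ L) fxyz≡c (f∈L _ _ _ hx hy hz x<y y<z))

_∩_ : Subset → Subset → Subset
(A ∩ B) n = A n ∧ B n

zeros : (ℕ → ℕ) → Subset
zeros q n = ifZero (q n) true false

module _ {H : Subset} {q : ℕ → ℕ} where

  ∩-zeros⁺ : ∀ {n} → H n ≡ true → q n ≡ 0 → (H ∩ zeros q) n ≡ true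
  ∩-zeros⁺ hn qn rewrite hn | qn = refl

  ∩-zeros⁻ : ∀ {n} → (H ∩ zeros q) n ≡ true → H n ≡ true × q n ≡ 0
  ∩-zeros⁻ {n} p with H n | q n
  ... | true | zero = refl , refl

  χ-∩-zeros : ∀ n → χ (H ∩ zeros q) n ≡ χ H n ∸ q n
  χ-∩-zeros n with H n | q n
  ... | true  | zero  = refl
  ... | true  | suc k = sym (0∸n≡0 k)
  ... | false | k     = sym (0∸n≡0 k)

  ∩-zeros-computable : ComputesFn (χ H) q → Computes H (H ∩ zeros q)
  ∩-zeros-computable (e , eval-e) = orc ⊝ e , λ n →
    subst (Eval (χ H) (orc ⊝ e) (n ∷ [])) (sym (χ-∩-zeros n)) (eval-⊝ ev-orc (eval-e n))

self-computable : (H : Subset) → Computes H H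
self-computable H = orc , λ _ → ev-orc

element-above : ∀ {H} → Infinite H → ∀ m n → ∃ λ k → m < k × n < k × H k ≡ true
element-above H-inf m n with H-inf (m ⊔ n)
... | k , m⊔n<k , hk = k , m⊔n<o⇒m<o m n m⊔n<k , m⊔n<o⇒n<o m n m⊔n<k , hk

from : ℕ → Subset → Subset
from N H = H ∩ zeros (N ∸_)

from-computable : ∀ N H → Computes H (from N H)
from-computable N H = ∩-zeros-computable (# N ⊝ proj Fin.zero , λ _ → eval-⊝ (eval-# N) ev-proj)

from⁻ : ∀ {N H n} → from N H n ≡ true → H n ≡ true × N ≤ n
from⁻ {N} {H} p with ∩-zeros⁻ {H} {N ∸_} p
... | hn , N∸n≡0 = hn , m∸n≡0⇒m≤n N∸n≡0

from-infinite : ∀ N {H} → Infinite H → Infinite (from N H)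
from-infinite N {H} H-inf n with element-above H-inf n N
... | k , n<k , N<k , hk = k , n<k , ∩-zeros⁺ {H} {N ∸_} hk (m≤n⇒m∸n≡0 (<⇒≤ N<k))

count : Subset → ℕ → ℕ
count H zero    = 0
count H (suc n) = χ H n + count H n

parity : ℕ → ℕ
parity zero    = 0
parity (suc n) = ifZero (parity n) 1 0

everyOther : Subset → Subset
everyOther H = H ∩ zeros (λ n → parity (count H n))

everyOther-computable : ∀ H → Computes H (everyOther H)
everyOther-computable H = ∩-zeros-computable
  (comp parityCode (countCode ∷ []) , λ n → ev-comp (eval-count n ∷ []) (eval-parity (count H n)))
  where
  countCode parityCode : Code 1
  countCode  = prec (# 0) (oracle (proj Fin.zero) ⊕ proj (Fin.suc Fin.zero))
  parityCode = prec (# 0) (ifZeroᶜ (proj (Fin.suc Fin.zero)) (# 1) (# 0))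

  eval-count : ∀ n → Eval (χ H) countCode (n ∷ []) (count H n)
  eval-count zero    = ev-prec0 ev-zer
  eval-count (suc n) = ev-precS (eval-count n) (eval-⊕ (eval-oracle ev-proj) ev-proj)

  eval-parity : ∀ n → Eval (χ H) parityCode (n ∷ []) (parity n)
  eval-parity zero    = ev-prec0 ev-zer
  eval-parity (suc n) = ev-precS (eval-parity n) (eval-ifZero ev-proj (eval-# 1) (eval-# 0))

module _ {H : Subset} where

  everyOther⁺ : ∀ {n} → H n ≡ true → parity (count H n) ≡ 0 → everyOther H n ≡ true
  everyOther⁺ = ∩-zeros⁺ {H} {λ n → parity (count H n)}

  everyOther⁻ : ∀ {n} → everyOther H n ≡ true → H n ≡ true × parity (count H n) ≡ 0
  everyOther⁻ = ∩-zeros⁻ {H} {λ n → parity (count H n)}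

  count-suc : ∀ {n} → H n ≡ true → count H (suc n) ≡ suc (count H n)
  count-suc hn rewrite hn = refl

  count-mono : ∀ {a b} → a ≤ b → count H a ≤ count H b
  count-mono {b = zero} z≤n = ≤-refl
  count-mono {b = suc b} a≤1+b with m≤n⇒m<n∨m≡n a≤1+b
  ... | inj₂ refl       = ≤-refl
  ... | inj₁ (s≤s a≤b) = ≤-trans (count-mono a≤b) (m≤n+m _ _)

  element-between : ∀ {a b} → a ≤ b → count H a < count H b → ∃ λ y → a ≤ y × y < b × H y ≡ true
  element-between {b = zero} z≤n ()
  element-between {b = suc b} a≤1+b count< with m≤n⇒m<n∨m≡n a≤1+b
  ... | inj₂ refl = ⊥-elim (<-irrefl refl count<)
  ... | inj₁ (s≤s a≤b) with H b in hb
  ...   | true  = b , a≤b , n<1+n b , hb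
  ...   | false with element-between a≤b count<
  ...     | y , a≤y , y<b , hy = y , a≤y , m<n⇒m<1+n y<b , hy

  first-element-from : ∀ d a → H (d + a) ≡ true → ∃ λ y → a ≤ y × H y ≡ true × count H y ≡ count H a
  first-element-from zero    a h = a , ≤-refl , h , refl
  first-element-from (suc d) a h with H a in ha
  ... | true  = a , ≤-refl , ha , refl
  ... | false with first-element-from d (suc a) (subst (λ t → H t ≡ true) (sym (+-suc d a)) h)
  ...   | y , a<y , hy , count-y rewrite ha = y , <⇒≤ a<y , hy , count-y

  everyOther-infinite : Infinite H → Infinite (everyOther H)
  everyOther-infinite H-inf n with H-inf n
  ... | m , n<m , hm with parity (count H m) in parity-m
  ...   | zero = m , n<m , everyOther⁺ hm parity-m
  ...   | suc _ with H-inf m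
  ...     | m′ , m<m′ , hm′ with first-element-from (m′ ∸ suc m) (suc m)
                                   (subst (λ t → H t ≡ true) (sym (m∸n+n≡m m<m′)) hm′)
  ...       | y , m<y , hy , count-y = y , <-trans n<m m<y , everyOther⁺ hy parity-y
    where
    parity-y : parity (count H y) ≡ 0
    parity-y rewrite count-y | count-suc hm | parity-m = refl

  everyOther-gap : ∀ {a b} → everyOther H a ≡ true → everyOther H b ≡ true → a < b →
                   ∃ λ y → a < y × y < b × H y ≡ true
  everyOther-gap {a} {b} xa xb a<b with everyOther⁻ xa | everyOther⁻ xb
  ... | ha , parity-a | _ , parity-b = element-between a<b (≤∧≢⇒< (count-mono a<b) count≢)
    where
    open ≡-Reasoning
    count≢ : count H (suc a) ≢ count H b
    count≢ eq = 1+n≢0 (begin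
      1                         ≡⟨ cong (λ p → ifZero p 1 0) (sym parity-a) ⟩
      parity (suc (count H a))  ≡⟨ cong parity (sym (count-suc ha)) ⟩
      parity (count H (suc a))  ≡⟨ cong parity eq ⟩
      parity (count H b)        ≡⟨ parity-b ⟩
      0                         ∎)

NoGSmallPair : (ℕ → ℕ) → Subset → Set
NoGSmallPair g X = ∀ {x y} → X x ≡ true → X y ≡ true → x < y → ¬ GSmall g x y

noGSmallPair⇒transitive : ∀ {g X} → NoGSmallPair g X → GTransitive g X
noGSmallPair⇒transitive none _ _ _ hx hy _ x<y _ small = ⊥-elim (none hx hy x<y small)

module _ (g : ℕ → ℕ) {H : Subset} (H-inf : Infinite H) where

  LL-unavoidable : ¬ Omits (colouring g) LL H
  LL-unavoidable omits with H-inf 0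
  ... | x , _ , hx with element-above H-inf x (g x)
  ...   | y , x<y , gx<y , hy with element-above H-inf y (g y)
  ...     | z , y<z , gy<z , hz =
    omits hx hy hz x<y y<z (colour-LL (m≤n⇒m∸n≡0 (<⇒≤ gx<y)) (m≤n⇒m∸n≡0 (<⇒≤ gy<z)))

  omits-SSL⇒transitive : Omits (colouring g) SSL H → GTransitive g H
  omits-SSL⇒transitive omits x y z hx hy hz x<y y<z small-xy small-yz with z <? g x
  ... | yes small-xz = small-xz
  ... | no  large-xz = ⊥-elim (omits hx hy hz x<y y<z
    (colour-SSL (m<n⇒0<n∸m small-xy) (m<n⇒0<n∸m small-yz) (m≤n⇒m∸n≡0 (≮⇒≥ large-xz))))

  omits-SL⇒noGSmallPair : Omits (colouring g) SL H → NoGSmallPair g H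
  omits-SL⇒noGSmallPair omits {y = y} hx hy x<y small-xy with element-above H-inf y (g y)
  ... | z , y<z , gy<z , hz =
    omits hx hy hz x<y y<z (colour-SL (m<n⇒0<n∸m small-xy) (m≤n⇒m∸n≡0 (<⇒≤ gy<z)))

  omits-LS⇒noGSmallPair : Omits (colouring g) LS H → ∀ {m} → H m ≡ true →
                          NoGSmallPair g (from (suc (m ⊔ g m)) H)
  omits-LS⇒noGSmallPair omits {m} hm hx hy x<y small-xy with from⁻ {H = H} hx | from⁻ {H = H} hy
  ... | hx′ , m⊔gm<x | hy′ , _ = omits hm hx′ hy′ (m⊔n<o⇒m<o m (g m) m⊔gm<x) x<y
    (colour-LS (m≤n⇒m∸n≡0 (<⇒≤ (m⊔n<o⇒n<o m (g m) m⊔gm<x))) (m<n⇒0<n∸m small-xy))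

  omits-SSS⇒noGSmallPair : StrictlyIncreasing g → Omits (colouring g) SSS H →
                           NoGSmallPair g (everyOther H)
  omits-SSS⇒noGSmallPair g-inc omits {a} xa xb a<b small-ab with everyOther-gap xa xb a<b
  ... | y , a<y , y<b , hy =
    omits (proj₁ (everyOther⁻ {H} xa)) hy (proj₁ (everyOther⁻ {H} xb)) a<y y<b
    (colour-SSS (m<n⇒0<n∸m (<-trans y<b small-ab))
                (m<n⇒0<n∸m (<-trans small-ab (g-inc a y a<y)))
                (m<n⇒0<n∸m small-ab))

  transitive-subset : StrictlyIncreasing g → ∀ c → Omits (colouring g) c H →
                      Σ Subset λ X → Infinite X × GTransitive g X × Computes H X
  transitive-subset _ LL omits = ⊥-elim (LL-unavoidable omits)
  transitive-subset _ LS omits with H-inf 0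
  ... | m , _ , hm = from N H , from-infinite N H-inf ,
                     noGSmallPair⇒transitive (omits-LS⇒noGSmallPair omits hm) , from-computable N H
    where N = suc (m ⊔ g m)
  transitive-subset _ SL omits =
    H , H-inf , noGSmallPair⇒transitive (omits-SL⇒noGSmallPair omits) , self-computable H
  transitive-subset _ SSL omits =
    H , H-inf , omits-SSL⇒transitive omits , self-computable H
  transitive-subset g-inc SSS omits =
    everyOther H , everyOther-infinite H-inf ,
    noGSmallPair⇒transitive (omits-SSS⇒noGSmallPair g-inc omits) , everyOther-computable H

theorem5p8 : (g : ℕ → ℕ) → StrictlyIncreasing g →
    Σ (Coloring3 5) λ f → ColoringComputableFrom g f ×
      ((H : Subset) → Infinite H → UsesAtMost 4 f H →
        Σ Subset λ X → Infinite X × GTransitive g X × Computes H X)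
theorem5p8 g g-inc = colouring g , colouring-computable g , λ H H-inf uses →
  let c , omits = omitted-colour (colouring g) uses (n<1+n 4)
  in transitive-subset g H-inf g-inc c omits
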